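{- Let $b\ge 2$ and $g\ge 3$ be integers, and let $(d_1,d_2,l,m,n)$ be integers with $1\le d_1,d_2\le g-1$, $n\ge0$, $1\le l\le m$, satisfying for some choice of signs $$(b\pm1)b^n\pm1=d_1\frac{g^l-1}{g-1}+d_2\frac{g^m-1}{g-1}.$$ Then $n<2.5\,m\log g$. -}

module Defs where

open import Data.Nat using (ℕ; zero; suc; _+_; _*_; _^_; _≤_; _<_; _!)
open import Data.List using (map; upTo)
open import Data.Nat.ListAction using (sum)
open import Data.Product using (∃-syntax; _×_)

-- repunit g l = 1 + g + ... + g^(l-1) = (g^l - 1)/(g - 1)   (exact quotient)
repunit : ℕ → ℕ → ℕ
repunit g l = sum (map (g ^_) (upTo l))

-- expNum k j = j! * Σ_{i=0}^{j} k^i / i!   (a natural number)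
expNum : ℕ → ℕ → ℕ
expNum k zero    = 1
expNum k (suc j) = suc j * expNum k j + k ^ suc j

-- ExpLt k N  means  e^k < N  (e = Euler's number), in the usual constructive
-- sense: there is a certified rational upper bound for e^k below N.
-- For j with 2k ≤ j + 2 the tail Σ_{i>j} k^i/i! is at most 2 k^(j+1)/(j+1)!,
-- so  e^k ≤ expNum k j / j! + 2 k^(j+1)/(j+1)!,  and the condition below is
-- this upper bound being < N, multiplied through by (j+1)!.
-- Conversely if e^k < N such a j exists (the bound tends to e^k).
ExpLt : ℕ → ℕ → Set
ExpLt k N = ∃[ j ] ((2 * k ≤ j + 2) × (suc j * expNum k j + 2 * k ^ suc j < N * (suc j) !))

-- As d₁, d₂ ≤ g − 1, the right-hand side is at most g^l + g^m − 2 ≤ 2g^m − 2, while the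
-- left-hand side is at least b^n − 1 ≥ 2^n − 1; hence 2^n < 2g^m, i.e. 2^(5n) < 32·g^(5m).
-- To certify e^(2n) < g^(5m), bound each Taylor term of e^k by k^i/i! ≤ 4^k: for i ≤ k this
-- is k^i·k! ≤ (i+k)! ≤ i!·k!·2^(i+k), and beyond i = k the terms decrease.  The degree-2k
-- certificate of ExpLt is then at most (2k + 3)·4^k, which for k = 2n is (4n + 3)·16^n, below
-- 2^(5n)/32 once n ≥ 11; the remaining n are settled by evaluating the certificate exactly.
module Submission where

open import Defs
open import Data.Nat using (ℕ; zero; suc; _+_; _*_; _^_; _≤_; _<_; _∸_; _⊔_; _!; z≤n; s≤s; _≤?_; _<?_; >-nonZero; allUpTo?)
open import Data.Nat.Properties
open import Data.Nat.Tactic.RingSolver using (solve-∀)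
open import Data.Nat.ListAction using (sum)
open import Data.Nat.ListAction.Properties using (sum-++)
open import Data.List using ([]; _∷_; _++_; map; upTo)
open import Data.List.Properties using (upTo-∷ʳ; map-++)
open import Data.Sum using (inj₁; inj₂)
open import Data.Product using (∃-syntax; _×_; _,_)
open import Data.Sign using (Sign)
open import Data.Integer as ℤ using (+_; _◃_)
import Data.Integer.Properties as ℤ
open import Relation.Binary.PropositionalEquality using (_≡_; refl; sym; trans; cong; subst; module ≡-Reasoning)
open import Relation.Nullary.Decidable using (Dec; yes; no; map′; toWitness)

repunit-suc : ∀ g m → repunit g (suc m) ≡ repunit g m + g ^ m
repunit-suc g m = begin
  sum (map (g ^_) (upTo (suc m)))          ≡⟨ cong (λ xs → sum (map (g ^_) xs)) (sym (upTo-∷ʳ m)) ⟩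
  sum (map (g ^_) (upTo m ++ m ∷ []))      ≡⟨ cong sum (map-++ (g ^_) (upTo m) (m ∷ [])) ⟩
  sum (map (g ^_) (upTo m) ++ g ^ m ∷ [])  ≡⟨ sum-++ (map (g ^_) (upTo m)) (g ^ m ∷ []) ⟩
  repunit g m + (g ^ m + 0)                ≡⟨ cong (λ t → repunit g m + t) (+-identityʳ (g ^ m)) ⟩
  repunit g m + g ^ m                      ∎
  where open ≡-Reasoning

repunit-mono : ∀ g {l m} → l ≤ m → repunit g l ≤ repunit g m
repunit-mono g {m = zero} z≤n = ≤-refl
repunit-mono g {l} {suc m} l≤1+m with m≤n⇒m<n∨m≡n l≤1+m
... | inj₁ (s≤s l≤m) = ≤-trans (repunit-mono g l≤m)
                               (≤-trans (m≤m+n (repunit g m) (g ^ m)) (≤-reflexive (sym (repunit-suc g m))))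
... | inj₂ refl = ≤-refl

repunit-geometric : ∀ h m → h * repunit (suc h) m + 1 ≡ suc h ^ m
repunit-geometric h zero = cong (_+ 1) (*-zeroʳ h)
repunit-geometric h (suc m) = begin
  h * repunit (suc h) (suc m) + 1  ≡⟨ cong (λ r → h * r + 1) (repunit-suc (suc h) m) ⟩
  h * (r + p) + 1                  ≡⟨ regroup h r p ⟩
  (h * r + 1) + h * p              ≡⟨ cong (_+ h * p) (repunit-geometric h m) ⟩
  p + h * p                        ∎
  where
  open ≡-Reasoning
  r = repunit (suc h) m
  p = suc h ^ m
  regroup : ∀ h r p → h * (r + p) + 1 ≡ (h * r + 1) + h * p
  regroup = solve-∀

digits*repunits<2*pow : ∀ {h d₁ d₂ l m} → d₁ ≤ h → d₂ ≤ h → l ≤ m →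
                        suc (d₁ * repunit (suc h) l + d₂ * repunit (suc h) m) < 2 * suc h ^ m
digits*repunits<2*pow {h} {d₁} {d₂} {l} {m} d₁≤h d₂≤h l≤m = begin-strict
  suc (d₁ * repunit (suc h) l + d₂ * R)  ≤⟨ s≤s (+-mono-≤ (*-mono-≤ d₁≤h (repunit-mono (suc h) l≤m))
                                                         (*-monoˡ-≤ R d₂≤h)) ⟩
  suc (h * R + h * R)                    <⟨ n<1+n _ ⟩
  2 + (h * R + h * R)                    ≡⟨ double-suc (h * R) ⟩
  2 * (h * R + 1)                        ≡⟨ cong (2 *_) (repunit-geometric h m) ⟩
  2 * suc h ^ m                          ∎
  where
  open ≤-Reasoning
  R = repunit (suc h) m
  double-suc : ∀ y → 2 + (y + y) ≡ 2 * (y + 1)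
  double-suc = solve-∀

m±1-natural : ∀ m ε → 1 ≤ m → ∃[ c ] (+ m ℤ.+ (ε ◃ 1) ≡ + c) × (m ≤ suc c)
m±1-natural m       Sign.+ _ = suc m , cong +_ (+-comm m 1) , ≤-trans (n≤1+n m) (n≤1+n (suc m))
m±1-natural (suc m) Sign.- _ = m , trans (ℤ.[1+m]⊖[1+n]≡m⊖n m 0) (ℤ.⊖-≥ z≤n) , ≤-refl

m±1≡x⇒m≤1+x : ∀ {m x} ε → 1 ≤ m → + m ℤ.+ (ε ◃ 1) ≡ + x → m ≤ suc x
m±1≡x⇒m≤1+x {m} ε 1≤m eq with m±1-natural m ε 1≤m
... | c , m±1≡c , m≤1+c = subst (λ y → m ≤ suc y) (ℤ.+-injective (trans (sym m±1≡c) eq)) m≤1+c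

[b±1]bⁿ±1≡x⇒bⁿ≤1+x : ∀ {b n x} ε₁ ε₂ → 2 ≤ b →
                      (+ b ℤ.+ (ε₁ ◃ 1)) ℤ.* + (b ^ n) ℤ.+ (ε₂ ◃ 1) ≡ + x → b ^ n ≤ suc x
[b±1]bⁿ±1≡x⇒bⁿ≤1+x {b} {n} {x} ε₁ ε₂ 2≤b eq with m±1-natural b ε₁ (≤-trans (s≤s z≤n) 2≤b)
... | c , b±1≡c , b≤1+c = ≤-trans (m≤n*m (b ^ n) c {{>-nonZero 1≤c}}) (m±1≡x⇒m≤1+x ε₂ 1≤c*bⁿ c*bⁿ±1≡x)
  where
  1≤c : 1 ≤ c
  1≤c = ≤-pred (≤-trans 2≤b b≤1+c)
  1≤c*bⁿ : 1 ≤ c * b ^ n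
  1≤c*bⁿ = *-mono-≤ 1≤c (≤-trans (m^n>0 2 n) (^-monoˡ-≤ n 2≤b))
  c*bⁿ±1≡x : + (c * b ^ n) ℤ.+ (ε₂ ◃ 1) ≡ + x
  c*bⁿ±1≡x = trans (cong (ℤ._+ (ε₂ ◃ 1)) (trans (ℤ.pos-* c (b ^ n)) (cong (ℤ._* + (b ^ n)) (sym b±1≡c)))) eq

[a+b]!≤a!*b!*2^[a+b] : ∀ a b → (a + b) ! ≤ a ! * b ! * 2 ^ (a + b)
[a+b]!≤a!*b!*2^[a+b] zero b = begin
  b !                ≡⟨ sym (*-identityˡ (b !)) ⟩
  1 * b !            ≤⟨ m≤m*n (1 * b !) (2 ^ b) {{m^n≢0 2 b}} ⟩
  1 * b ! * 2 ^ b    ∎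
  where open ≤-Reasoning
[a+b]!≤a!*b!*2^[a+b] (suc a) zero = subst (λ s → s ! ≤ suc a ! * 1 * 2 ^ s) (sym (+-identityʳ (suc a))) (begin
  suc a !                    ≡⟨ sym (*-identityʳ (suc a !)) ⟩
  suc a ! * 1                ≤⟨ m≤m*n (suc a ! * 1) (2 ^ suc a) {{m^n≢0 2 (suc a)}} ⟩
  suc a ! * 1 * 2 ^ suc a    ∎)
  where open ≤-Reasoning
[a+b]!≤a!*b!*2^[a+b] (suc a) (suc b) = begin
  (suc a + suc b) * s !                                      ≡⟨ *-distribʳ-+ (s !) (suc a) (suc b) ⟩
  suc a * s ! + suc b * s !                                  ≤⟨ +-mono-≤ (*-monoʳ-≤ (suc a) ([a+b]!≤a!*b!*2^[a+b] a (suc b)))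
                                                                         (*-monoʳ-≤ (suc b) s!≤[1+a]!b!2ˢ) ⟩
  suc a * (a ! * suc b ! * P) + suc b * (suc a ! * b ! * P)  ≡⟨ pascal a (a !) b (b !) P ⟩
  suc a ! * suc b ! * (2 * P)                                ∎
  where
  open ≤-Reasoning
  s = a + suc b
  P = 2 ^ s
  s!≤[1+a]!b!2ˢ : s ! ≤ suc a ! * b ! * P
  s!≤[1+a]!b!2ˢ = subst (λ t → t ! ≤ suc a ! * b ! * 2 ^ t) (sym (+-suc a b)) ([a+b]!≤a!*b!*2^[a+b] (suc a) b)
  pascal : ∀ a A b B P → (1 + a) * (A * ((1 + b) * B) * P) + (1 + b) * ((1 + a) * A * B * P)
                         ≡ (1 + a) * A * ((1 + b) * B) * (2 * P)
  pascal = solve-∀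

kᵈ*k!≤[d+k]! : ∀ d k → k ^ d * k ! ≤ (d + k) !
kᵈ*k!≤[d+k]! zero k = ≤-reflexive (+-identityʳ (k !))
kᵈ*k!≤[d+k]! (suc d) k = begin
  k * k ^ d * k !          ≡⟨ *-assoc k (k ^ d) (k !) ⟩
  k * (k ^ d * k !)        ≤⟨ *-mono-≤ (m≤n+m k (suc d)) (kᵈ*k!≤[d+k]! d k) ⟩
  suc (d + k) * (d + k) !  ∎
  where open ≤-Reasoning

i≤k⇒kⁱ≤i!*4ᵏ : ∀ {k i} → i ≤ k → k ^ i ≤ i ! * 4 ^ k
i≤k⇒kⁱ≤i!*4ᵏ {k} {i} i≤k = *-cancelʳ-≤ (k ^ i) (i ! * 4 ^ k) (k !) {{k !≢0}} (begin
  k ^ i * k !              ≤⟨ kᵈ*k!≤[d+k]! i k ⟩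
  (i + k) !                ≤⟨ [a+b]!≤a!*b!*2^[a+b] i k ⟩
  i ! * k ! * 2 ^ (i + k)  ≤⟨ *-monoʳ-≤ (i ! * k !) (^-monoʳ-≤ 2 (+-monoˡ-≤ k i≤k)) ⟩
  i ! * k ! * 2 ^ (k + k)  ≡⟨ cong (λ e → i ! * k ! * 2 ^ (k + e)) (sym (+-identityʳ k)) ⟩
  i ! * k ! * 2 ^ (2 * k)  ≡⟨ cong (i ! * k ! *_) (sym (^-*-assoc 2 2 k)) ⟩
  i ! * k ! * 4 ^ k        ≡⟨ swap (i !) (k !) (4 ^ k) ⟩
  i ! * 4 ^ k * k !        ∎)
  where
  open ≤-Reasoning
  swap : ∀ a b c → a * b * c ≡ a * c * b
  swap = solve-∀

kⁱ≤i!*4ᵏ : ∀ k i → k ^ i ≤ i ! * 4 ^ k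
kⁱ≤i!*4ᵏ k i with ≤-total i k
... | inj₁ i≤k = i≤k⇒kⁱ≤i!*4ᵏ i≤k
... | inj₂ k≤i = subst (λ j → k ^ j ≤ j ! * 4 ^ k) (trans (+-comm d k) (m+[n∸m]≡n k≤i)) (begin
  k ^ (d + k)              ≡⟨ ^-distribˡ-+-* k d k ⟩
  k ^ d * k ^ k            ≤⟨ *-monoʳ-≤ (k ^ d) (i≤k⇒kⁱ≤i!*4ᵏ {k} ≤-refl) ⟩
  k ^ d * (k ! * 4 ^ k)    ≡⟨ sym (*-assoc (k ^ d) (k !) (4 ^ k)) ⟩
  k ^ d * k ! * 4 ^ k      ≤⟨ *-monoˡ-≤ (4 ^ k) (kᵈ*k!≤[d+k]! d k) ⟩
  (d + k) ! * 4 ^ k        ∎)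
  where
  open ≤-Reasoning
  d = i ∸ k

record ExpLtCert (k N : ℕ) : Set where
  constructor cert
  field bound : suc (2 * k) * expNum k (2 * k) + 2 * k ^ suc (2 * k) < N * suc (2 * k) !

ExpLtCert? : ∀ k N → Dec (ExpLtCert k N)
ExpLtCert? k N = map′ cert ExpLtCert.bound (_ <? _)

cert⇒ExpLt : ∀ {k N} → ExpLtCert k N → ExpLt k N
cert⇒ExpLt {k} (cert bound) = 2 * k , m≤m+n (2 * k) 2 , bound

cert-mono : ∀ {k N M} → N ≤ M → ExpLtCert k N → ExpLtCert k M
cert-mono {k} N≤M (cert bound) = cert (<-≤-trans bound (*-monoˡ-≤ (suc (2 * k) !) N≤M))

expNum≤[1+j]!*4ᵏ : ∀ k j → expNum k j ≤ suc j ! * 4 ^ k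
expNum≤[1+j]!*4ᵏ k zero = ≤-trans (m^n>0 4 k) (≤-reflexive (sym (+-identityʳ (4 ^ k))))
expNum≤[1+j]!*4ᵏ k (suc j) = begin
  suc j * expNum k j + k ^ suc j        ≤⟨ +-mono-≤ (*-monoʳ-≤ (suc j) (expNum≤[1+j]!*4ᵏ k j))
                                                    (kⁱ≤i!*4ᵏ k (suc j)) ⟩
  suc j * (suc j ! * P) + suc j ! * P   ≡⟨ collect j (suc j !) P ⟩
  (2 + j) * suc j ! * P                 ∎
  where
  open ≤-Reasoning
  P = 4 ^ k
  collect : ∀ j F P → (1 + j) * (F * P) + F * P ≡ (2 + j) * F * P
  collect = solve-∀

[2k+3]4ᵏ<N⇒cert : ∀ k N → (2 * k + 3) * 4 ^ k < N → ExpLtCert k N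
[2k+3]4ᵏ<N⇒cert k N bound = cert (begin-strict
  suc j * expNum k j + 2 * k ^ suc j         ≤⟨ +-mono-≤ (*-monoʳ-≤ (suc j) (expNum≤[1+j]!*4ᵏ k j))
                                                         (*-monoʳ-≤ 2 (kⁱ≤i!*4ᵏ k (suc j))) ⟩
  suc j * (suc j ! * P) + 2 * (suc j ! * P)  ≡⟨ collect j (suc j !) P ⟩
  (j + 3) * P * suc j !                      <⟨ *-monoˡ-< (suc j !) {{suc j !≢0}} bound ⟩
  N * suc j !                                ∎)
  where
  open ≤-Reasoning
  j = 2 * k
  P = 4 ^ k
  collect : ∀ j F P → (1 + j) * (F * P) + 2 * (F * P) ≡ (j + 3) * P * F
  collect = solve-∀

32[4n+3]≤2ⁿ : ∀ {n} → 11 ≤ n → 32 * (2 * (2 * n) + 3) ≤ 2 ^ n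
32[4n+3]≤2ⁿ {n} 11≤n = subst Bound (m+[n∸m]≡n 11≤n) (from-11 (n ∸ 11))
  where
  Bound : ℕ → Set
  Bound n = 32 * (2 * (2 * n) + 3) ≤ 2 ^ n
  step : ∀ d → 2 * (32 * (2 * (2 * (11 + d)) + 3)) ≡ 32 * (2 * (2 * (12 + d)) + 3) + (128 * d + 1376)
  step = solve-∀
  from-11 : ∀ d → Bound (11 + d)
  from-11 zero = toWitness {a? = 32 * (2 * (2 * 11) + 3) ≤? 2 ^ 11} _
  from-11 (suc d) = begin
    32 * (2 * (2 * (12 + d)) + 3)                     ≤⟨ m≤m+n _ (128 * d + 1376) ⟩
    32 * (2 * (2 * (12 + d)) + 3) + (128 * d + 1376)  ≡⟨ sym (step d) ⟩
    2 * (32 * (2 * (2 * (11 + d)) + 3))               ≤⟨ *-monoʳ-≤ 2 (from-11 d) ⟩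
    2 ^ (12 + d)                                      ∎
    where open ≤-Reasoning

[2ⁿ]⁵≡2ⁿ*4^2n : ∀ n → (2 ^ n) ^ 5 ≡ 2 ^ n * 4 ^ (2 * n)
[2ⁿ]⁵≡2ⁿ*4^2n n = begin
  (2 ^ n) ^ 5                ≡⟨ ^-*-assoc 2 n 5 ⟩
  2 ^ (n * 5)                ≡⟨ cong (2 ^_) (split n) ⟩
  2 ^ (n + 2 * (2 * n))      ≡⟨ ^-distribˡ-+-* 2 n (2 * (2 * n)) ⟩
  2 ^ n * 2 ^ (2 * (2 * n))  ≡⟨ cong (2 ^ n *_) (sym (^-*-assoc 2 2 (2 * n))) ⟩
  2 ^ n * 4 ^ (2 * n)        ∎
  where
  open ≡-Reasoning
  split : ∀ n → n * 5 ≡ n + 2 * (2 * n)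
  split = solve-∀

large-cert : ∀ {n G} → 11 ≤ n → 2 ^ n < 2 * G → ExpLtCert (2 * n) (G ^ 5)
large-cert {n} {G} 11≤n 2ⁿ<2G = [2k+3]4ᵏ<N⇒cert (2 * n) (G ^ 5) (*-cancelˡ-< 32 _ _ (begin-strict
  32 * ((2 * (2 * n) + 3) * Q)  ≡⟨ sym (*-assoc 32 (2 * (2 * n) + 3) Q) ⟩
  32 * (2 * (2 * n) + 3) * Q    ≤⟨ *-monoˡ-≤ Q (32[4n+3]≤2ⁿ 11≤n) ⟩
  2 ^ n * Q                     ≡⟨ sym ([2ⁿ]⁵≡2ⁿ*4^2n n) ⟩
  (2 ^ n) ^ 5                   <⟨ ^-monoˡ-< 5 2ⁿ<2G ⟩
  (2 * G) ^ 5                   ≡⟨ fifth G ⟩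
  32 * G ^ 5                    ∎))
  where
  open ≤-Reasoning
  Q = 4 ^ (2 * n)
  fifth : ∀ x → let y = 2 * x in y * (y * (y * (y * (y * 1)))) ≡ 32 * (x * (x * (x * (x * (x * 1)))))
  fifth = solve-∀

-- The least G compatible with 3 ≤ G and 2^n < 2G.
smallBound : ℕ → ℕ
smallBound n = 3 ⊔ suc (2 ^ (n ∸ 1))

smallBound≤ : ∀ {n G} → 3 ≤ G → 2 ^ n < 2 * G → smallBound n ≤ G
smallBound≤ {zero}  3≤G _     = ⊔-lub 3≤G (≤-trans (s≤s (s≤s z≤n)) 3≤G)
smallBound≤ {suc p} 3≤G 2ⁿ<2G = ⊔-lub 3≤G (*-cancelˡ-< 2 (2 ^ p) _ 2ⁿ<2G)

small-cert : ∀ {n} → n < 11 → ExpLtCert (2 * n) (smallBound n ^ 5)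
small-cert = toWitness {a? = allUpTo? (λ n → ExpLtCert? (2 * n) (smallBound n ^ 5)) 11} _

2ⁿ<2G⇒ExpLt : ∀ n G → 3 ≤ G → 2 ^ n < 2 * G → ExpLt (2 * n) (G ^ 5)
2ⁿ<2G⇒ExpLt n G 3≤G 2ⁿ<2G with n <? 11
... | yes n<11 = cert⇒ExpLt (cert-mono (^-monoˡ-≤ 5 (smallBound≤ {n} 3≤G 2ⁿ<2G)) (small-cert n<11))
... | no  n≮11 = cert⇒ExpLt (large-cert {n} {G} (≮⇒≥ n≮11) 2ⁿ<2G)

lemma5 : (b g d₁ d₂ l m n : ℕ) (ε₁ ε₂ : Sign) →
         2 ≤ b → 3 ≤ g →
         1 ≤ d₁ → d₁ ≤ g ∸ 1 → 1 ≤ d₂ → d₂ ≤ g ∸ 1 →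
         1 ≤ l → l ≤ m →
         ((+ b ℤ.+ (ε₁ ◃ 1)) ℤ.* (+ (b ^ n)) ℤ.+ (ε₂ ◃ 1)) ≡ + (d₁ * repunit g l + d₂ * repunit g m) →
         ExpLt (2 * n) (g ^ (5 * m))
lemma5 b (suc h) d₁ d₂ l m n ε₁ ε₂ 2≤b 3≤g _ d₁≤h _ d₂≤h 1≤l l≤m eq =
  subst (ExpLt (2 * n)) (trans (^-*-assoc g m 5) (cong (g ^_) (*-comm m 5)))
        (2ⁿ<2G⇒ExpLt n (g ^ m) 3≤gᵐ 2ⁿ<2gᵐ)
  where
  open ≤-Reasoning
  g = suc h
  3≤gᵐ : 3 ≤ g ^ m
  3≤gᵐ = ≤-trans 3≤g (≤-trans (≤-reflexive (sym (*-identityʳ g))) (^-monoʳ-≤ g (≤-trans 1≤l l≤m)))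
  2ⁿ<2gᵐ : 2 ^ n < 2 * g ^ m
  2ⁿ<2gᵐ = begin-strict
    2 ^ n                                     ≤⟨ ^-monoˡ-≤ n 2≤b ⟩
    b ^ n                                     ≤⟨ [b±1]bⁿ±1≡x⇒bⁿ≤1+x {n = n} ε₁ ε₂ 2≤b eq ⟩
    suc (d₁ * repunit g l + d₂ * repunit g m) <⟨ digits*repunits<2*pow d₁≤h d₂≤h l≤m ⟩
    2 * g ^ m                                 ∎
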